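{- Let $\mathds{k}$ be a field, $q\in\mathds{k}$, and let $\mathds{k}\langle x,y\rangle$ be the free algebra graded by word length. Then for all $n\ge0$, $$(x+y)^n=\sum_{k=0}^n\binom{n}{k}_q\widehat{B}_{k,q}(x,y)\,x^{n-k}.$$
   Context: For homogeneous $w\in\mathds{k}\langle x,y\rangle$ of degree $|w|$, set $\operatorname{ad}_qx(w)=xw-q^{|w|}wx$, extended linearly (this is $\operatorname{ad}_\sigma x$ for the algebra map $\sigma(w)=q^{|w|}w$). The $q$-Bell differential polynomials are $\widehat{B}_{0,q}=1$ and $\widehat{B}_{n,q}(x,y)=(\operatorname{ad}_qx+y)^n(1)$ for $n\ge1$, where $(\operatorname{ad}_qx+y)(w)=\operatorname{ad}_qx(w)+yw$. $(n)_q=1+q+\cdots+q^{n-1}$ ($(0)_q=0$), $(n)_q!=(1)_q(2)_q\cdots(n)_q$, and $\binom{n}{k}_q=\frac{(n)_q!}{(k)_q!(n-k)_q!}$ (the Gaussian binomial coefficient, a polynomial in $q$). -}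

module Defs where

open import Level using (_⊔_)
open import Algebra.Bundles using (CommutativeRing)
open import Data.Bool using (Bool; true; false)
import Data.Bool as Bool
open import Data.List using (List; []; _∷_; _++_; map; concatMap; length; upTo)
open import Data.List.Properties using (≡-dec)
open import Data.Nat using (ℕ; zero; suc; _∸_)
open import Data.Product using (_×_; _,_)
open import Relation.Nullary using (¬_; yes; no)
open import Relation.Binary.PropositionalEquality using (_≡_)

IsField : ∀ {c ℓ} → CommutativeRing c ℓ → Set (c ⊔ ℓ)
IsField R = ¬ (1# ≈ 0#) × (∀ a → ¬ (a ≈ 0#) → Σ Carrier (λ b → a * b ≈ 1#))
  where open CommutativeRing R
        open import Data.Product using (Σ)

module FreeAlg {c ℓ} (R : CommutativeRing c ℓ) where
  open CommutativeRing R

  -- Letters: false = x, true = y.  Words in x,y; degree = length.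
  Word : Set
  Word = List Bool

  Poly : Set c
  Poly = List (Carrier × Word)

  coeff : Poly → Word → Carrier
  coeff [] w = 0#
  coeff ((a , u) ∷ p) w with ≡-dec Bool._≟_ u w
  ... | yes _ = a + coeff p w
  ... | no _ = coeff p w

  infix 4 _≋_
  _≋_ : Poly → Poly → Set ℓ
  p ≋ r = ∀ w → coeff p w ≈ coeff r w

  infixl 6 _⊕_
  _⊕_ : Poly → Poly → Poly
  p ⊕ r = p ++ r

  zeroP : Poly
  zeroP = []

  oneP : Poly
  oneP = (1# , []) ∷ []

  X Y : Poly
  X = (1# , false ∷ []) ∷ []
  Y = (1# , true ∷ []) ∷ []

  scale : Carrier → Poly → Poly
  scale a p = map (λ { (b , w) → (a * b , w) }) p

  infixl 7 _⊗_
  _⊗_ : Poly → Poly → Poly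
  p ⊗ r = concatMap (λ { (a , u) → map (λ { (b , v) → (a * b , u ++ v) }) r }) p

  powP : Poly → ℕ → Poly
  powP p zero = oneP
  powP p (suc n) = p ⊗ powP p n

  pow : Carrier → ℕ → Carrier
  pow a zero = 1#
  pow a (suc n) = a * pow a n

  sumP : List Poly → Poly
  sumP [] = zeroP
  sumP (p ∷ ps) = p ⊕ sumP ps

  module _ (q : Carrier) where
    adq : Poly → Poly
    adq p = concatMap (λ { (a , w) →
              (a , false ∷ w) ∷ (- (pow q (length w) * a) , w ++ (false ∷ [])) ∷ [] }) p

    step : Poly → Poly
    step p = adq p ⊕ Y ⊗ p

    Bhat : ℕ → Poly
    Bhat zero = oneP
    Bhat (suc n) = step (Bhat n)

    qbinom : ℕ → ℕ → Carrier
    qbinom zero zero = 1#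
    qbinom zero (suc k) = 0#
    qbinom (suc n) zero = 1#
    qbinom (suc n) (suc k) = qbinom n k + pow q (suc k) * qbinom n (suc k)

    rhs : ℕ → Poly
    rhs n = sumP (map (λ k → scale (qbinom n k) (Bhat k ⊗ powP X (n ∸ k))) (upTo (suc n)))

-- For p homogeneous of degree k one has x p = ad_q x (p) + q^k p x, i.e.
--   (x + y) p = (ad_q x + y)(p) + q^k p x.
-- As B̂_k is homogeneous of degree k, (x + y) B̂_k x^m = B̂_{k+1} x^m + q^k B̂_k x^{m+1}, and
-- induction on n with the q-Pascal rule [n+1, k+1]_q = [n, k]_q + q^{k+1} [n, k+1]_q gives the
-- expansion.  The rule is applied in the form (x + y)(p r) = (ad_q x + y)(p) r + q^k p (x r) and
-- checked monomial by monomial.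
module Submission where

open import Defs
open import Algebra.Bundles using (CommutativeRing; CommutativeMonoid)
open import Data.Nat using (ℕ)

open import Algebra.Structures using (IsCommutativeMonoid)
import Algebra.Properties.CommutativeSemigroup as CommutativeSemigroupProperties
open import Data.Bool using (true; false)
import Data.Bool as Bool
open import Data.Empty using (⊥-elim)
open import Data.List using (List; []; _∷_; _++_; map; concat; concatMap; length; applyUpTo)
open import Data.List.Properties
  using (≡-dec; ∷-injectiveˡ; ∷-injectiveʳ; ++-assoc; ++-identityʳ; map-++; map-∘; concat-++; length-++)
open import Data.List.Relation.Unary.All using (All; []; _∷_)
open import Data.List.Relation.Unary.All.Properties using (++⁺)
open import Data.Nat using (zero; suc; _≤_; _<_; _∸_; s≤s; z≤n)
import Data.Nat.Properties as ℕ
open import Data.Product using (_×_; _,_; proj₁; proj₂)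
open import Function using (_∘_; id)
open import Relation.Binary.Bundles using (Setoid)
open import Relation.Binary.Structures using (IsEquivalence)
import Relation.Binary.Reasoning.Setoid as SetoidReasoning
import Relation.Binary.PropositionalEquality as ≡
open ≡ using (_≡_; _≢_)
open import Relation.Nullary using (Dec; yes; no)

concatMap-++ : ∀ {a b} {A : Set a} {B : Set b} (f : A → List B) xs ys →
               concatMap f (xs ++ ys) ≡ concatMap f xs ++ concatMap f ys
concatMap-++ f xs ys =
  ≡.trans (≡.cong concat (map-++ f xs ys)) (≡.sym (concat-++ (map f xs) (map f ys)))

module _ {c ℓ} (R : CommutativeRing c ℓ) where
  open CommutativeRing R
  open FreeAlg R

  coeff-++ : ∀ p r w → coeff (p ++ r) w ≈ coeff p w + coeff r w
  coeff-++ [] r w = sym (+-identityˡ _)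
  coeff-++ ((a , u) ∷ p) r w with ≡-dec Bool._≟_ u w
  ... | yes _ = trans (+-congˡ (coeff-++ p r w)) (sym (+-assoc _ _ _))
  ... | no _ = coeff-++ p r w

  coeff-∷-≡ : ∀ {a u w} p → u ≡ w → coeff ((a , u) ∷ p) w ≈ a + coeff p w
  coeff-∷-≡ {u = u} {w} p u≡w with ≡-dec Bool._≟_ u w
  ... | yes _ = refl
  ... | no u≢w = ⊥-elim (u≢w u≡w)

  coeff-∷-≢ : ∀ {a u w} p → u ≢ w → coeff ((a , u) ∷ p) w ≈ coeff p w
  coeff-∷-≢ {u = u} {w} p u≢w with ≡-dec Bool._≟_ u w
  ... | yes u≡w = ⊥-elim (u≢w u≡w)
  ... | no _ = refl

  coeff-scale : ∀ a p w → coeff (scale a p) w ≈ a * coeff p w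
  coeff-scale a [] w = sym (zeroʳ a)
  coeff-scale a ((b , u) ∷ p) w with ≡-dec Bool._≟_ u w
  ... | yes _ = trans (+-congˡ (coeff-scale a p w)) (sym (distribˡ a b _))
  ... | no _ = coeff-scale a p w

  -- _≋_ unfolds to a Π-type, through which unification cannot recover its arguments;
  -- wrapping it in a record makes the arguments of lemmas about it inferable.
  infix 4 _≃_
  record _≃_ (p r : Poly) : Set ℓ where
    constructor coeffwise
    field coeff-≈ : p ≋ r
  open _≃_ public

  ≃-isEquivalence : IsEquivalence _≃_
  ≃-isEquivalence = record
    { refl = coeffwise λ w → refl
    ; sym = λ e → coeffwise λ w → sym (coeff-≈ e w)
    ; trans = λ e f → coeffwise λ w → trans (coeff-≈ e w) (coeff-≈ f w)
    }

  ≃-setoid : Setoid c ℓ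
  ≃-setoid = record { isEquivalence = ≃-isEquivalence }

  open Setoid ≃-setoid public
    using () renaming (refl to ≃-refl; sym to ≃-sym; trans to ≃-trans; reflexive to ≃-reflexive)
  module ≃-Reasoning = SetoidReasoning ≃-setoid

  ⊕-isCommutativeMonoid : IsCommutativeMonoid _≃_ _⊕_ zeroP
  ⊕-isCommutativeMonoid = record
    { isMonoid = record
      { isSemigroup = record
        { isMagma = record
          { isEquivalence = ≃-isEquivalence
          ; ∙-cong = λ {p} {p′} {r} {r′} p≃p′ r≃r′ → coeffwise λ w →
              trans (coeff-++ p r w)
                    (trans (+-cong (coeff-≈ p≃p′ w) (coeff-≈ r≃r′ w)) (sym (coeff-++ p′ r′ w)))
          }
        ; assoc = λ p r s → ≃-reflexive (++-assoc p r s)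
        }
      ; identity = (λ p → ≃-refl) , (λ p → ≃-reflexive (++-identityʳ p))
      }
    ; comm = λ p r → coeffwise λ w → trans (coeff-++ p r w) (trans (+-comm _ _) (sym (coeff-++ r p w)))
    }

  ⊕-commutativeMonoid : CommutativeMonoid c ℓ
  ⊕-commutativeMonoid = record { isCommutativeMonoid = ⊕-isCommutativeMonoid }

  open IsCommutativeMonoid ⊕-isCommutativeMonoid public using () renaming
    (∙-cong to ⊕-cong; assoc to ⊕-assoc; identityʳ to ⊕-identityʳ)

  ⊕-congˡ : ∀ p {r r′} → r ≃ r′ → p ⊕ r ≃ p ⊕ r′
  ⊕-congˡ p = ⊕-cong (≃-refl {p})

  ⊕-congʳ : ∀ r {p p′} → p ≃ p′ → p ⊕ r ≃ p′ ⊕ r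
  ⊕-congʳ r p≃p′ = ⊕-cong p≃p′ (≃-refl {r})

  open CommutativeSemigroupProperties (CommutativeMonoid.commutativeSemigroup ⊕-commutativeMonoid)
    using (interchange; x∙yz≈y∙xz)

  scale-congˡ : ∀ {a b} → a ≈ b → ∀ p → scale a p ≃ scale b p
  scale-congˡ {a} {b} a≈b p = coeffwise λ w →
    trans (coeff-scale a p w) (trans (*-congʳ a≈b) (sym (coeff-scale b p w)))

  scale-congʳ : ∀ a {p r} → p ≃ r → scale a p ≃ scale a r
  scale-congʳ a {p} {r} p≃r = coeffwise λ w →
    trans (coeff-scale a p w) (trans (*-congˡ (coeff-≈ p≃r w)) (sym (coeff-scale a r w)))

  scale-⊕ : ∀ a p r → scale a (p ⊕ r) ≡ scale a p ⊕ scale a r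
  scale-⊕ a = map-++ _

  scale-distribʳ : ∀ a b p → scale (a + b) p ≃ scale a p ⊕ scale b p
  scale-distribʳ a b p = coeffwise λ w → trans (coeff-scale (a + b) p w) (trans (distribʳ _ a b) (sym
    (trans (coeff-++ (scale a p) (scale b p) w) (+-cong (coeff-scale a p w) (coeff-scale b p w)))))

  scale-scale : ∀ a b p → scale a (scale b p) ≃ scale (a * b) p
  scale-scale a b p = coeffwise λ w → trans (coeff-scale a (scale b p) w) (trans (*-congˡ (coeff-scale b p w))
    (trans (sym (*-assoc a b _)) (sym (coeff-scale (a * b) p w))))

  scale-zero : ∀ {a} p → a ≈ 0# → scale a p ≃ zeroP
  scale-zero {a} p a≈0 = coeffwise λ w → trans (coeff-scale a p w) (trans (*-congʳ a≈0) (zeroˡ _))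

  coeff-map-cong : ∀ {t} {T : Set t} {f g : T → Carrier × Word} →
                   (∀ x → proj₁ (f x) ≈ proj₁ (g x)) → (∀ x → proj₂ (f x) ≡ proj₂ (g x)) →
                   ∀ xs → map f xs ≃ map g xs
  coeff-map-cong {f = f} {g} f≈g f≡g xs = coeffwise (pointwise xs)
    where
    pointwise : ∀ xs → map f xs ≋ map g xs
    pointwise [] w = refl
    pointwise (x ∷ xs) w with ≡-dec Bool._≟_ (proj₂ (f x)) w | ≡-dec Bool._≟_ (proj₂ (g x)) w
    ... | yes _ | yes _ = +-cong (f≈g x) (pointwise xs w)
    ... | no _  | no _  = pointwise xs w
    ... | yes e | no ne = ⊥-elim (ne (≡.trans (≡.sym (f≡g x)) e))
    ... | no ne | yes e = ⊥-elim (ne (≡.trans (f≡g x) e))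

  lmul : Carrier → Word → Poly → Poly
  lmul a u = map (λ t → (a * proj₁ t , u ++ proj₂ t))

  singleton-⊗ : ∀ a u r → ((a , u) ∷ []) ⊗ r ≡ lmul a u r
  singleton-⊗ a u r = ++-identityʳ (lmul a u r)

  singleton-⊗-++ : ∀ a u p r → ((a , u) ∷ []) ⊗ (p ++ r) ≡ ((a , u) ∷ []) ⊗ p ++ ((a , u) ∷ []) ⊗ r
  singleton-⊗-++ a u [] r = ≡.refl
  singleton-⊗-++ a u (t ∷ p) r = ≡.cong (_ ∷_) (singleton-⊗-++ a u p r)

  ⊗-distribʳ-++ : ∀ p p′ r → (p ++ p′) ⊗ r ≡ p ⊗ r ++ p′ ⊗ r
  ⊗-distribʳ-++ p p′ r = concatMap-++ _ p p′

  lmul-cong : ∀ {a b} u r → a ≈ b → lmul a u r ≃ lmul b u r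
  lmul-cong u r a≈b = coeff-map-cong (λ _ → *-congʳ a≈b) (λ _ → ≡.refl) r

  lmul-lmul : ∀ a b u v r → lmul a u (lmul b v r) ≃ lmul (a * b) (u ++ v) r
  lmul-lmul a b u v r = ≃-trans (≃-reflexive (≡.sym (map-∘ r)))
    (coeff-map-cong (λ t → sym (*-assoc a b (proj₁ t))) (λ t → ≡.sym (++-assoc u v (proj₂ t))) r)

  scale-lmul : ∀ a b u r → scale a (lmul b u r) ≃ lmul (a * b) u r
  scale-lmul a b u r = ≃-trans (≃-reflexive (≡.sym (map-∘ r)))
    (coeff-map-cong (λ t → sym (*-assoc a b (proj₁ t))) (λ _ → ≡.refl) r)

  lmul-inverse : ∀ a u r → lmul (- a) u r ⊕ lmul a u r ≃ zeroP
  lmul-inverse a u r = begin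
    lmul (- a) u r ⊕ lmul a u r        ≈⟨ ⊕-cong (as-scale (- a)) (as-scale a) ⟩
    scale (- a) s ⊕ scale a s          ≈⟨ ≃-sym (scale-distribʳ (- a) a s) ⟩
    scale (- a + a) s                  ≈⟨ scale-zero s (-‿inverseˡ a) ⟩
    zeroP                              ∎
    where
    open ≃-Reasoning
    s = lmul 1# u r
    as-scale : ∀ b → lmul b u r ≃ scale b s
    as-scale b = ≃-sym (≃-trans (scale-lmul b 1# u r) (lmul-cong u r (*-identityʳ b)))

  coeff-lmul-∷-[] : ∀ a l u r → coeff (lmul a (l ∷ u) r) [] ≈ 0#
  coeff-lmul-∷-[] a l u [] = refl
  coeff-lmul-∷-[] a l u ((b , v) ∷ r) with ≡-dec Bool._≟_ (l ∷ u ++ v) []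
  ... | no _ = coeff-lmul-∷-[] a l u r

  coeff-lmul-∷-≢ : ∀ a {l l′} u r w → l ≢ l′ → coeff (lmul a (l ∷ u) r) (l′ ∷ w) ≈ 0#
  coeff-lmul-∷-≢ a u [] w l≢l′ = refl
  coeff-lmul-∷-≢ a {l} {l′} u ((b , v) ∷ r) w l≢l′ with ≡-dec Bool._≟_ (l ∷ u ++ v) (l′ ∷ w)
  ... | yes e = ⊥-elim (l≢l′ (∷-injectiveˡ e))
  ... | no _ = coeff-lmul-∷-≢ a u r w l≢l′

  coeff-lmul-letter : ∀ a l r w → coeff (lmul a (l ∷ []) r) (l ∷ w) ≈ a * coeff r w
  coeff-lmul-letter a l [] w = sym (zeroʳ a)
  coeff-lmul-letter a l ((b , v) ∷ r) w = by-cases (≡-dec Bool._≟_ v w)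
    where
    by-cases : Dec (v ≡ w) → coeff (lmul a (l ∷ []) ((b , v) ∷ r)) (l ∷ w) ≈ a * coeff ((b , v) ∷ r) w
    by-cases (yes v≡w) =
      trans (coeff-∷-≡ {a * b} _ (≡.cong (l ∷_) v≡w)) (trans (+-congˡ (coeff-lmul-letter a l r w))
            (trans (sym (distribˡ a b _)) (*-congˡ (sym (coeff-∷-≡ r v≡w)))))
    by-cases (no v≢w) = trans (coeff-∷-≢ {a * b} {l ∷ v} {l ∷ w} _ (v≢w ∘ ∷-injectiveʳ))
                          (trans (coeff-lmul-letter a l r w) (*-congˡ (sym (coeff-∷-≢ r v≢w))))

  x+y⊗-letters : ∀ s → (X ⊕ Y) ⊗ s ≡ lmul 1# (false ∷ []) s ⊕ lmul 1# (true ∷ []) s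
  x+y⊗-letters s = ≡.cong (lmul 1# (false ∷ []) s ++_) (++-identityʳ _)

  coeff-x+y⊗-[] : ∀ s → coeff ((X ⊕ Y) ⊗ s) [] ≈ 0#
  coeff-x+y⊗-[] s = begin
    coeff ((X ⊕ Y) ⊗ s) []
      ≡⟨ ≡.cong (λ t → coeff t []) (x+y⊗-letters s) ⟩
    coeff (lmul 1# (false ∷ []) s ⊕ lmul 1# (true ∷ []) s) []
      ≈⟨ coeff-++ (lmul 1# (false ∷ []) s) _ [] ⟩
    coeff (lmul 1# (false ∷ []) s) [] + coeff (lmul 1# (true ∷ []) s) []
      ≈⟨ +-cong (coeff-lmul-∷-[] 1# false [] s) (coeff-lmul-∷-[] 1# true [] s) ⟩
    0# + 0#                                                       ≈⟨ +-identityʳ 0# ⟩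
    0#                                                            ∎
    where open SetoidReasoning setoid

  coeff-x+y⊗-∷ : ∀ s l w → coeff ((X ⊕ Y) ⊗ s) (l ∷ w) ≈ coeff s w
  coeff-x+y⊗-∷ s l w = trans (reflexive (≡.cong (λ t → coeff t (l ∷ w)) (x+y⊗-letters s)))
                              (trans (coeff-++ (lmul 1# (false ∷ []) s) _ (l ∷ w)) (letters l))
    where
    letters : ∀ l → coeff (lmul 1# (false ∷ []) s) (l ∷ w) + coeff (lmul 1# (true ∷ []) s) (l ∷ w)
                    ≈ coeff s w
    letters false = trans (+-cong (coeff-lmul-letter 1# false s w) (coeff-lmul-∷-≢ 1# [] s w λ ()))
                          (trans (+-identityʳ _) (*-identityˡ _))
    letters true = trans (+-cong (coeff-lmul-∷-≢ 1# [] s w λ ()) (coeff-lmul-letter 1# true s w))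
                         (trans (+-identityˡ _) (*-identityˡ _))

  x+y⊗-cong : ∀ {s s′} → s ≃ s′ → (X ⊕ Y) ⊗ s ≃ (X ⊕ Y) ⊗ s′
  x+y⊗-cong {s} {s′} s≃s′ = coeffwise λ where
    [] → trans (coeff-x+y⊗-[] s) (sym (coeff-x+y⊗-[] s′))
    (l ∷ w) → trans (coeff-x+y⊗-∷ s l w) (trans (coeff-≈ s≃s′ w) (sym (coeff-x+y⊗-∷ s′ l w)))

  x+y⊗-⊕ : ∀ s s′ → (X ⊕ Y) ⊗ (s ⊕ s′) ≃ (X ⊕ Y) ⊗ s ⊕ (X ⊕ Y) ⊗ s′
  x+y⊗-⊕ s s′ = coeffwise λ where
    [] → trans (coeff-x+y⊗-[] (s ⊕ s′)) (sym (trans (coeff-++ ((X ⊕ Y) ⊗ s) _ [])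
           (trans (+-cong (coeff-x+y⊗-[] s) (coeff-x+y⊗-[] s′)) (+-identityʳ 0#))))
    (l ∷ w) → trans (coeff-x+y⊗-∷ (s ⊕ s′) l w) (trans (coeff-++ s s′ w)
                (sym (trans (coeff-++ ((X ⊕ Y) ⊗ s) _ _)
                            (+-cong (coeff-x+y⊗-∷ s l w) (coeff-x+y⊗-∷ s′ l w)))))

  x+y⊗-scale : ∀ a s → (X ⊕ Y) ⊗ scale a s ≃ scale a ((X ⊕ Y) ⊗ s)
  x+y⊗-scale a s = coeffwise λ where
    [] → trans (coeff-x+y⊗-[] (scale a s))
           (sym (trans (coeff-scale a ((X ⊕ Y) ⊗ s) []) (trans (*-congˡ (coeff-x+y⊗-[] s)) (zeroʳ a))))
    (l ∷ w) → trans (coeff-x+y⊗-∷ (scale a s) l w) (trans (coeff-scale a s w)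
                (sym (trans (coeff-scale a ((X ⊕ Y) ⊗ s) _) (*-congˡ (coeff-x+y⊗-∷ s l w)))))

  x+y⊗-lmul : ∀ a u r → (X ⊕ Y) ⊗ lmul a u r ≃ lmul a (false ∷ u) r ⊕ lmul a (true ∷ u) r
  x+y⊗-lmul a u r = ≃-trans (≃-reflexive (x+y⊗-letters (lmul a u r))) (⊕-cong (prepend false) (prepend true))
    where
    prepend : ∀ l → lmul 1# (l ∷ []) (lmul a u r) ≃ lmul a (l ∷ u) r
    prepend l = ≃-trans (lmul-lmul 1# a (l ∷ []) u r) (lmul-cong (l ∷ u) r (*-identityˡ a))

  sumUpTo : ℕ → (ℕ → Poly) → Poly
  sumUpTo zero f = zeroP
  sumUpTo (suc m) f = f 0 ⊕ sumUpTo m (f ∘ suc)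

  sumP-applyUpTo : ∀ (f : ℕ → Poly) (g : ℕ → ℕ) m → sumP (map f (applyUpTo g m)) ≡ sumUpTo m (f ∘ g)
  sumP-applyUpTo f g zero = ≡.refl
  sumP-applyUpTo f g (suc m) = ≡.cong (f (g 0) ⊕_) (sumP-applyUpTo f (g ∘ suc) m)

  sumUpTo-cong : ∀ m {f g} → (∀ k → k < m → f k ≃ g k) → sumUpTo m f ≃ sumUpTo m g
  sumUpTo-cong zero f≃g = ≃-refl
  sumUpTo-cong (suc m) {f} {g} f≃g =
    ⊕-cong (f≃g 0 (s≤s z≤n)) (sumUpTo-cong m {f ∘ suc} {g ∘ suc} (λ k k<m → f≃g (suc k) (s≤s k<m)))

  sumUpTo-⊕ : ∀ m f g → sumUpTo m (λ k → f k ⊕ g k) ≃ sumUpTo m f ⊕ sumUpTo m g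
  sumUpTo-⊕ zero f g = ≃-refl
  sumUpTo-⊕ (suc m) f g =
    ≃-trans (⊕-congˡ (f 0 ⊕ g 0) (sumUpTo-⊕ m (f ∘ suc) (g ∘ suc)))
            (interchange (f 0) (g 0) (sumUpTo m (f ∘ suc)) (sumUpTo m (g ∘ suc)))

  sumUpTo-last : ∀ m f → sumUpTo (suc m) f ≃ sumUpTo m f ⊕ f m
  sumUpTo-last zero f = ⊕-identityʳ (f 0)
  sumUpTo-last (suc m) f =
    ≃-trans (⊕-congˡ (f 0) (sumUpTo-last m (f ∘ suc)))
            (≃-sym (⊕-assoc (f 0) (sumUpTo m (f ∘ suc)) (f (suc m))))

  x+y⊗-sumUpTo : ∀ m f → (X ⊕ Y) ⊗ sumUpTo m f ≃ sumUpTo m (λ k → (X ⊕ Y) ⊗ f k)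
  x+y⊗-sumUpTo zero f = ≃-refl
  x+y⊗-sumUpTo (suc m) f =
    ≃-trans (x+y⊗-⊕ (f 0) (sumUpTo m (f ∘ suc))) (⊕-congˡ ((X ⊕ Y) ⊗ f 0) (x+y⊗-sumUpTo m (f ∘ suc)))

  Homogeneous : ℕ → Poly → Set c
  Homogeneous k = All (λ t → length (proj₂ t) ≡ k)

  module _ (q : Carrier) where

    adq-homogeneous : ∀ {k p} → Homogeneous k p → Homogeneous (suc k) (adq q p)
    adq-homogeneous [] = []
    adq-homogeneous {p = (a , u) ∷ p} (|u|≡k ∷ h) =
      ≡.cong suc |u|≡k ∷ ≡.trans (length-++ u) (≡.trans (ℕ.+-comm (length u) 1) (≡.cong suc |u|≡k))
                       ∷ adq-homogeneous h

    Y⊗-homogeneous : ∀ {k p} → Homogeneous k p → Homogeneous (suc k) (Y ⊗ p)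
    Y⊗-homogeneous [] = []
    Y⊗-homogeneous (|u|≡k ∷ h) = ≡.cong suc |u|≡k ∷ Y⊗-homogeneous h

    Bhat-homogeneous : ∀ k → Homogeneous k (Bhat q k)
    Bhat-homogeneous zero = ≡.refl ∷ []
    Bhat-homogeneous (suc k) = ++⁺ (adq-homogeneous (Bhat-homogeneous k)) (Y⊗-homogeneous (Bhat-homogeneous k))

    step-⊗-++ : ∀ p p′ r → step q (p ++ p′) ⊗ r ≃ step q p ⊗ r ⊕ step q p′ ⊗ r
    step-⊗-++ p p′ r = begin
      step q (p ++ p′) ⊗ r
        ≡⟨ ≡.cong (_⊗ r) (≡.cong₂ _++_ (concatMap-++ _ p p′) (singleton-⊗-++ 1# (true ∷ []) p p′)) ⟩
      ((adq q p ++ adq q p′) ++ (Y ⊗ p ++ Y ⊗ p′)) ⊗ r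
        ≡⟨ distribute (adq q p) (adq q p′) (Y ⊗ p) (Y ⊗ p′) ⟩
      (adq q p ⊗ r ⊕ adq q p′ ⊗ r) ⊕ ((Y ⊗ p) ⊗ r ⊕ (Y ⊗ p′) ⊗ r)
        ≈⟨ interchange (adq q p ⊗ r) (adq q p′ ⊗ r) ((Y ⊗ p) ⊗ r) ((Y ⊗ p′) ⊗ r) ⟩
      (adq q p ⊗ r ⊕ (Y ⊗ p) ⊗ r) ⊕ (adq q p′ ⊗ r ⊕ (Y ⊗ p′) ⊗ r)
        ≡⟨ ≡.sym (≡.cong₂ _⊕_ (⊗-distribʳ-++ (adq q p) _ r) (⊗-distribʳ-++ (adq q p′) _ r)) ⟩
      step q p ⊗ r ⊕ step q p′ ⊗ r
        ∎
      where
      open ≃-Reasoning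
      distribute : ∀ s₁ s₂ s₃ s₄ →
                   ((s₁ ++ s₂) ++ (s₃ ++ s₄)) ⊗ r ≡ (s₁ ⊗ r ⊕ s₂ ⊗ r) ⊕ (s₃ ⊗ r ⊕ s₄ ⊗ r)
      distribute s₁ s₂ s₃ s₄ = ≡.trans (⊗-distribʳ-++ (s₁ ++ s₂) (s₃ ++ s₄) r)
                                       (≡.cong₂ _++_ (⊗-distribʳ-++ s₁ s₂ r) (⊗-distribʳ-++ s₃ s₄ r))

    x+y⊗-monomial : ∀ a u r →
      (X ⊕ Y) ⊗ (((a , u) ∷ []) ⊗ r) ≃
      step q ((a , u) ∷ []) ⊗ r ⊕ scale (pow q (length u)) (((a , u) ∷ []) ⊗ (X ⊗ r))
    x+y⊗-monomial a u r = begin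
      (X ⊕ Y) ⊗ (((a , u) ∷ []) ⊗ r)      ≡⟨ ≡.cong ((X ⊕ Y) ⊗_) (singleton-⊗ a u r) ⟩
      (X ⊕ Y) ⊗ lmul a u r                ≈⟨ x+y⊗-lmul a u r ⟩
      F ⊕ T                               ≈⟨ ≃-sym (⊕-identityʳ (F ⊕ T)) ⟩
      (F ⊕ T) ⊕ zeroP                     ≈⟨ ⊕-congˡ (F ⊕ T) (≃-sym (lmul-inverse (Q * a) ux r)) ⟩
      (F ⊕ T) ⊕ (N ⊕ P)                   ≈⟨ interchange F T N P ⟩
      (F ⊕ N) ⊕ (T ⊕ P)                   ≈⟨ ≃-sym (⊕-assoc (F ⊕ N) T P) ⟩
      ((F ⊕ N) ⊕ T) ⊕ P                   ≈⟨ ⊕-cong (⊕-assoc F N T) (≃-sym P-from-right) ⟩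
      (F ⊕ (N ⊕ T)) ⊕ scale Q (((a , u) ∷ []) ⊗ (X ⊗ r))
        ≈⟨ ⊕-congʳ (scale Q (((a , u) ∷ []) ⊗ (X ⊗ r))) (⊕-congˡ F (⊕-congˡ N T-from-left)) ⟩
      step q ((a , u) ∷ []) ⊗ r ⊕ scale Q (((a , u) ∷ []) ⊗ (X ⊗ r))
        ∎
      where
      open ≃-Reasoning
      Q = pow q (length u)
      ux = u ++ false ∷ []
      F = lmul a (false ∷ u) r
      T = lmul a (true ∷ u) r
      N = lmul (- (Q * a)) ux r
      P = lmul (Q * a) ux r
      T-from-left : T ≃ lmul (1# * a) (true ∷ u) r ⊕ zeroP
      T-from-left = ≃-sym (≃-trans (⊕-identityʳ _) (lmul-cong (true ∷ u) r (*-identityˡ a)))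
      P-from-right : scale Q (((a , u) ∷ []) ⊗ (X ⊗ r)) ≃ P
      P-from-right = begin
        scale Q (((a , u) ∷ []) ⊗ (X ⊗ r))
          ≡⟨ ≡.cong (scale Q)
                    (≡.trans (singleton-⊗ a u _) (≡.cong (lmul a u) (singleton-⊗ 1# (false ∷ []) r))) ⟩
        scale Q (lmul a u (lmul 1# (false ∷ []) r))   ≈⟨ scale-lmul Q a u _ ⟩
        lmul (Q * a) u (lmul 1# (false ∷ []) r)       ≈⟨ lmul-lmul (Q * a) 1# u (false ∷ []) r ⟩
        lmul (Q * a * 1#) ux r                        ≈⟨ lmul-cong ux r (*-identityʳ (Q * a)) ⟩
        P                                             ∎

    x+y⊗-homogeneous : ∀ {k p} r → Homogeneous k p →
      (X ⊕ Y) ⊗ (p ⊗ r) ≃ step q p ⊗ r ⊕ scale (pow q k) (p ⊗ (X ⊗ r))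
    x+y⊗-homogeneous r [] = ≃-refl
    x+y⊗-homogeneous {p = (a , u) ∷ p} r (≡.refl ∷ h) = begin
      (X ⊕ Y) ⊗ (((a , u) ∷ p) ⊗ r)         ≡⟨ ≡.cong ((X ⊕ Y) ⊗_) (⊗-distribʳ-++ m p r) ⟩
      (X ⊕ Y) ⊗ (m ⊗ r ⊕ p ⊗ r)             ≈⟨ x+y⊗-⊕ (m ⊗ r) (p ⊗ r) ⟩
      (X ⊕ Y) ⊗ (m ⊗ r) ⊕ (X ⊕ Y) ⊗ (p ⊗ r)
        ≈⟨ ⊕-cong (x+y⊗-monomial a u r) (x+y⊗-homogeneous r h) ⟩
      (step q m ⊗ r ⊕ scale Q (m ⊗ Xr)) ⊕ (step q p ⊗ r ⊕ scale Q (p ⊗ Xr))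
        ≈⟨ interchange (step q m ⊗ r) (scale Q (m ⊗ Xr)) (step q p ⊗ r) (scale Q (p ⊗ Xr)) ⟩
      (step q m ⊗ r ⊕ step q p ⊗ r) ⊕ (scale Q (m ⊗ Xr) ⊕ scale Q (p ⊗ Xr))
        ≈⟨ ⊕-congʳ (scale Q (m ⊗ Xr) ⊕ scale Q (p ⊗ Xr)) (≃-sym (step-⊗-++ m p r)) ⟩
      step q ((a , u) ∷ p) ⊗ r ⊕ (scale Q (m ⊗ Xr) ⊕ scale Q (p ⊗ Xr))
        ≡⟨ ≡.cong (step q ((a , u) ∷ p) ⊗ r ⊕_)
                  (≡.sym (≡.trans (≡.cong (scale Q) (⊗-distribʳ-++ m p Xr))
                                  (scale-⊕ Q (m ⊗ Xr) (p ⊗ Xr)))) ⟩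
      step q ((a , u) ∷ p) ⊗ r ⊕ scale Q (((a , u) ∷ p) ⊗ Xr)
        ∎
      where
      open ≃-Reasoning
      m = (a , u) ∷ []
      Q = pow q (length u)
      Xr = X ⊗ r

    x+y⊗-Bhat⊗X^ : ∀ k m →
      (X ⊕ Y) ⊗ (Bhat q k ⊗ powP X m) ≃
      Bhat q (suc k) ⊗ powP X m ⊕ scale (pow q k) (Bhat q k ⊗ powP X (suc m))
    x+y⊗-Bhat⊗X^ k m = x+y⊗-homogeneous (powP X m) (Bhat-homogeneous k)

    qbinom-zeroʳ : ∀ n → qbinom q n 0 ≡ 1#
    qbinom-zeroʳ zero = ≡.refl
    qbinom-zeroʳ (suc n) = ≡.refl

    qbinom-vanishes : ∀ {n k} → n < k → qbinom q n k ≈ 0#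
    qbinom-vanishes {zero} {suc k} _ = refl
    qbinom-vanishes {suc n} {suc k} (s≤s n<k) = trans
      (+-cong (qbinom-vanishes n<k) (trans (*-congˡ (qbinom-vanishes (ℕ.m<n⇒m<1+n n<k))) (zeroʳ _)))
      (+-identityʳ 0#)

    binomialTerm : ℕ → ℕ → Poly
    binomialTerm n k = scale (qbinom q n k) (Bhat q k ⊗ powP X (n ∸ k))

    rhs≡sumUpTo : ∀ n → rhs q n ≡ sumUpTo (suc n) (binomialTerm n)
    rhs≡sumUpTo n = sumP-applyUpTo (binomialTerm n) id (suc n)

    x+y⊗-binomialTerm : ∀ {n k} → k ≤ n →
      (X ⊕ Y) ⊗ binomialTerm n k ≃
      scale (qbinom q n k) (Bhat q (suc k) ⊗ powP X (n ∸ k)) ⊕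
      scale (qbinom q n k * pow q k) (Bhat q k ⊗ powP X (suc n ∸ k))
    x+y⊗-binomialTerm {n} {k} k≤n = begin
      (X ⊕ Y) ⊗ scale b (Bhat q k ⊗ powP X (n ∸ k))
        ≈⟨ x+y⊗-scale b (Bhat q k ⊗ powP X (n ∸ k)) ⟩
      scale b ((X ⊕ Y) ⊗ (Bhat q k ⊗ powP X (n ∸ k)))
        ≈⟨ scale-congʳ b (x+y⊗-Bhat⊗X^ k (n ∸ k)) ⟩
      scale b (B′ ⊕ scale (pow q k) B)
        ≡⟨ scale-⊕ b B′ (scale (pow q k) B) ⟩
      scale b B′ ⊕ scale b (scale (pow q k) B)
        ≈⟨ ⊕-congˡ (scale b B′) (scale-scale b (pow q k) B) ⟩
      scale b B′ ⊕ scale (b * pow q k) B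
        ≡⟨ ≡.cong (λ e → scale b B′ ⊕ scale (b * pow q k) (Bhat q k ⊗ powP X e)) (≡.sym (ℕ.+-∸-assoc 1 k≤n)) ⟩
      scale b B′ ⊕ scale (b * pow q k) (Bhat q k ⊗ powP X (suc n ∸ k))
        ∎
      where
      open ≃-Reasoning
      b : Carrier
      b = qbinom q n k
      B B′ : Poly
      B = Bhat q k ⊗ powP X (suc (n ∸ k))
      B′ = Bhat q (suc k) ⊗ powP X (n ∸ k)

    binomial-step : ∀ n →
      (X ⊕ Y) ⊗ sumUpTo (suc n) (binomialTerm n) ≃ sumUpTo (suc (suc n)) (binomialTerm (suc n))
    binomial-step n = begin
      (X ⊕ Y) ⊗ sumUpTo (suc n) (binomialTerm n)
        ≈⟨ x+y⊗-sumUpTo (suc n) (binomialTerm n) ⟩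
      sumUpTo (suc n) (λ k → (X ⊕ Y) ⊗ binomialTerm n k)
        ≈⟨ sumUpTo-cong (suc n) (λ k k<1+n → x+y⊗-binomialTerm (ℕ.≤-pred k<1+n)) ⟩
      sumUpTo (suc n) (λ k → U k ⊕ V k)
        ≈⟨ sumUpTo-⊕ (suc n) U V ⟩
      sumUpTo (suc n) U ⊕ sumUpTo (suc n) V
        ≈⟨ ⊕-congˡ (sumUpTo (suc n) U) V-extend ⟩
      sumUpTo (suc n) U ⊕ (V 0 ⊕ sumUpTo (suc n) (V ∘ suc))
        ≈⟨ x∙yz≈y∙xz (sumUpTo (suc n) U) (V 0) (sumUpTo (suc n) (V ∘ suc)) ⟩
      V 0 ⊕ (sumUpTo (suc n) U ⊕ sumUpTo (suc n) (V ∘ suc))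
        ≈⟨ ⊕-cong V-zero (≃-sym (sumUpTo-⊕ (suc n) U (V ∘ suc))) ⟩
      binomialTerm (suc n) 0 ⊕ sumUpTo (suc n) (λ j → U j ⊕ V (suc j))
        ≈⟨ ⊕-congˡ (binomialTerm (suc n) 0) (sumUpTo-cong (suc n) (λ j _ → ≃-sym (q-pascal j))) ⟩
      sumUpTo (suc (suc n)) (binomialTerm (suc n))
        ∎
      where
      open ≃-Reasoning
      U V : ℕ → Poly
      U k = scale (qbinom q n k) (Bhat q (suc k) ⊗ powP X (n ∸ k))
      V k = scale (qbinom q n k * pow q k) (Bhat q k ⊗ powP X (suc n ∸ k))

      V-extend : sumUpTo (suc n) V ≃ sumUpTo (suc (suc n)) V
      V-extend = ≃-trans (≃-sym (⊕-identityʳ (sumUpTo (suc n) V)))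
        (≃-trans (⊕-congˡ (sumUpTo (suc n) V) (≃-sym V-top-vanishes)) (≃-sym (sumUpTo-last (suc n) V)))
        where
        V-top-vanishes : V (suc n) ≃ zeroP
        V-top-vanishes = scale-zero _ (trans (*-congʳ (qbinom-vanishes (ℕ.n<1+n n))) (zeroˡ _))

      V-zero : V 0 ≃ binomialTerm (suc n) 0
      V-zero = scale-congˡ (trans (*-identityʳ _) (reflexive (qbinom-zeroʳ n))) (Bhat q 0 ⊗ powP X (suc n))

      q-pascal : ∀ j → binomialTerm (suc n) (suc j) ≃ U j ⊕ V (suc j)
      q-pascal j = ≃-trans (scale-distribʳ (qbinom q n j) (pow q (suc j) * qbinom q n (suc j)) t)
                           (⊕-congˡ (U j) (scale-congˡ (*-comm (pow q (suc j)) (qbinom q n (suc j))) t))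
        where t = Bhat q (suc j) ⊗ powP X (n ∸ j)

    binomial-theorem : ∀ n → powP (X ⊕ Y) n ≃ sumUpTo (suc n) (binomialTerm n)
    -- Both sides are the single monomial ε, with coefficients 1 and 1 · (1 · 1).
    binomial-theorem zero = coeff-map-cong {f = id} {g = λ t → (1# * (1# * proj₁ t) , proj₂ t)}
      (λ _ → sym (trans (*-identityˡ _) (*-identityˡ _))) (λ _ → ≡.refl) oneP
    binomial-theorem (suc n) = ≃-trans (x+y⊗-cong (binomial-theorem n)) (binomial-step n)

corollary3p5 : ∀ {c ℓ} (K : CommutativeRing c ℓ) → IsField K →
    (q : CommutativeRing.Carrier K) (n : ℕ) →
    FreeAlg._≋_ K (FreeAlg.powP K (FreeAlg._⊕_ K (FreeAlg.X K) (FreeAlg.Y K)) n) (FreeAlg.rhs K q n)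
corollary3p5 K _ q n rewrite rhs≡sumUpTo K q n = coeff-≈ (binomial-theorem K q n)
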